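{- Let $\mathcal{S}$ be any one of the step sets $\mathcal{A},\mathcal{B},\mathcal{C},\mathcal{D},\mathcal{E}$. For any $k\ge1$ and any point $Q_k$ of the segment $S_k=\{(i,j)\in\mathbb{Z}^2: i,j\ge0,\ i+j=k\}$, one has $\sum_{n\ge0}\frac{\#_{\mathcal{S}}\{(0,0)\stackrel{n}{\to}Q_k\}}{2^n}\in\mathbb{Q}$.
   Context: Write N=(0,1), E=(1,0), NE=(1,1), NW=(-1,1), SE=(1,-1); $\mathcal{A}=\{\mathrm{NW},\mathrm{NE},\mathrm{SE}\}$, $\mathcal{B}=\{\mathrm{NW},\mathrm{N},\mathrm{E},\mathrm{SE}\}$, $\mathcal{C}=\{\mathrm{NW},\mathrm{N},\mathrm{NE},\mathrm{E},\mathrm{SE}\}$, $\mathcal{D}=\{\mathrm{NW},\mathrm{N},\mathrm{SE}\}$, $\mathcal{E}=\{\mathrm{NW},\mathrm{N},\mathrm{NE},\mathrm{SE}\}$. $\#_{\mathcal{S}}\{(0,0)\stackrel{n}{\to}Q\}$ is the number of walks of length $n$ with steps in $\mathcal{S}$, starting at $(0,0)$, ending at $Q$, all of whose points lie in $\mathbb{N}^2$. -}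

module Defs where

open import Data.Nat as ℕ using (ℕ; zero; suc)
open import Data.Integer as ℤ using (ℤ; +_; -[1+_]; 0ℤ)
open import Data.Product using (_×_; _,_; proj₁; proj₂)
open import Data.List using (List; []; _∷_; map; concatMap; length; filter; foldr)
open import Data.Bool using (T; T?; Bool; true; false; _∧_; if_then_else_)
open import Relation.Nullary.Decidable using (⌊_⌋)
open import Data.Rational as ℚ using (ℚ; 0ℚ; ½)

Point : Set
Point = ℤ × ℤ

N E NE NW SE : Point
N  = (0ℤ , + 1)
E  = (+ 1 , 0ℤ)
NE = (+ 1 , + 1)
NW = (-[1+ 0 ] , + 1)
SE = (+ 1 , -[1+ 0 ])

data StepSet : Set where
  𝒜 ℬ 𝒞 𝒟 ℰ : StepSet

steps : StepSet → List Point
steps 𝒜 = NW ∷ NE ∷ SE ∷ []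
steps ℬ = NW ∷ N ∷ E ∷ SE ∷ []
steps 𝒞 = NW ∷ N ∷ NE ∷ E ∷ SE ∷ []
steps 𝒟 = NW ∷ N ∷ SE ∷ []
steps ℰ = NW ∷ N ∷ NE ∷ SE ∷ []

sequences : List Point → ℕ → List (List Point)
sequences S zero    = [] ∷ []
sequences S (suc n) = concatMap (λ s → map (s ∷_) (sequences S n)) S

_+ᵖ_ : Point → Point → Point
(a , b) +ᵖ (c , d) = (a ℤ.+ c , b ℤ.+ d)

inQuadrant : Point → Bool
inQuadrant (a , b) = ⌊ 0ℤ ℤ.≤? a ⌋ ∧ ⌊ 0ℤ ℤ.≤? b ⌋

eqPoint : Point → Point → Bool
eqPoint (a , b) (c , d) = ⌊ a ℤ.≟ c ⌋ ∧ ⌊ b ℤ.≟ d ⌋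

-- A walk (sequence of steps) started at point P stays in ℕ² and ends at Q.
-- (The starting point P is assumed to be checked by the caller.)
validFrom : Point → Point → List Point → Bool
validFrom P Q []       = eqPoint P Q
validFrom P Q (s ∷ w)  = inQuadrant (P +ᵖ s) ∧ validFrom (P +ᵖ s) Q w

countWalks : StepSet → ℕ → Point → ℕ
countWalks S n Q = length (filter (λ w → T? (validFrom (0ℤ , 0ℤ) Q w)) (sequences (steps S) n))

halfPow : ℕ → ℚ
halfPow zero    = ℚ.1ℚ
halfPow (suc n) = ½ ℚ.* halfPow n

partialSum : StepSet → Point → ℕ → ℚ
partialSum S Q zero    = 0ℚ
partialSum S Q (suc M) = partialSum S Q M ℚ.+ (+ countWalks S M Q ℚ./ 1) ℚ.* halfPow M

PartialSumsConvergeTo : (ℕ → ℚ) → ℚ → Set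
PartialSumsConvergeTo s q =
  ∀ (ε : ℚ) → 0ℚ ℚ.< ε → Σ ℕ λ K → ∀ M → K ℕ.≤ M → ℚ.∣ s M ℚ.- q ∣ ℚ.< ε
  where open import Data.Product using (Σ)

{-# OPTIONS --safe #-}
module Submission where

-- The generating function F (P) = Σₙ #{P →ⁿ Q} / 2ⁿ solves F = δ_Q + T F, where the
-- transfer T f (P) is half the sum of f over the neighbours P + s (s ∈ 𝒮) lying in ℕ².
-- Every step of 𝒮 keeps or raises the level i + j, NW and SE being the ones that keep it,
-- so this equation can be solved on the levels i + j ≤ k one after the other from k
-- downwards: on each level it is a discrete Dirichlet problem
-- x i = β i + (x (i - 1) + x (i + 1)) / 2 on a segment, whose solution is rational.
-- Above k we take 0. This gives a rational fixed point G.
--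
-- The errors e M = (partial sum up to M) - G satisfy e (M + 1) = T (e M), so
-- ∣ e M ∣ ≤ Tᴹ ∣ G ∣. A supersolution v ≥ 0 with ∣ G ∣ + T v ≤ v, built from the concave
-- profile (i + 1) (j + 1) on each level with weights growing fast towards lower levels,
-- bounds Σ Tᴹ ∣ G ∣ by v. Hence Σ ∣ e M (0, 0) ∣ is bounded, and since e M (0, 0)
-- increases with M, it tends to 0.

open import Defs
open import Data.Bool using (Bool; true; false; T?; if_then_else_)
open import Data.Empty using (⊥; ⊥-elim)
open import Data.Integer as ℤ using (+_; -[1+_]; 0ℤ)
open import Data.List using (List; []; _∷_; map; filter; length; concatMap)
open import Data.List.Properties using (length-++; filter-++)
open import Data.Nat as ℕ using (ℕ; zero; suc)
import Data.Nat.Properties as ℕₚ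
open import Data.Product using (Σ; _,_; proj₁; proj₂)
open import Data.Rational as ℚ using (ℚ; 0ℚ; 1ℚ; ½; mkℚ; ∣_∣)
import Data.Rational.Properties as ℚₚ
open import Data.Sum using (inj₁; inj₂)
open import Function using (_∘_; const)
open import Relation.Binary.PropositionalEquality
open import Relation.Nullary using (yes; no)

module Rationals where

  open import Data.Rational using (_+_; -_; _*_; 1/_; _/_; _≤_; _<_; _<?_)
  open import Data.Nat.Coprimality using (1-coprimeTo)
  import Data.Nat.Coprimality as Coprime
  import Data.Integer.Properties as ℤₚ
  open import Data.Rational.Solver using (module +-*-Solver)
  open +-*-Solver

  fromℕ : ℕ → ℚ
  fromℕ n = + n / 1

  fromℕ-mkℚ : ∀ n → fromℕ n ≡ mkℚ (+ n) 0 (Coprime.sym (1-coprimeTo n))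
  fromℕ-mkℚ n = ℚₚ.normalize-coprime (Coprime.sym (1-coprimeTo n))

  fromℕ-+ : ∀ m n → fromℕ (m ℕ.+ n) ≡ fromℕ m + fromℕ n
  fromℕ-+ m n rewrite fromℕ-mkℚ m | fromℕ-mkℚ n =
    ℚₚ./-cong (sym (cong₂ ℤ._+_ (ℤₚ.*-identityʳ (+ m)) (ℤₚ.*-identityʳ (+ n)))) refl

  fromℕ-mono-≤ : ∀ {m n} → m ℕ.≤ n → fromℕ m ≤ fromℕ n
  fromℕ-mono-≤ {m} {n} m≤n rewrite fromℕ-mkℚ m | fromℕ-mkℚ n =
    ℚ.*≤* (subst₂ ℤ._≤_ (sym (ℤₚ.*-identityʳ (+ m))) (sym (ℤₚ.*-identityʳ (+ n))) (ℤ.+≤+ m≤n))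

  fromℕ-nonNeg : ∀ n → 0ℚ ≤ fromℕ n
  fromℕ-nonNeg n = fromℕ-mono-≤ {0} {n} ℕ.z≤n

  fromℕ-pos : ∀ n → 0ℚ < fromℕ (suc n)
  fromℕ-pos n rewrite fromℕ-mkℚ (suc n) = ℚ.*<* (ℤ.+<+ (ℕ.s≤s ℕ.z≤n))

  fromℕ-unbounded : ∀ p → Σ ℕ λ K → p < fromℕ K
  fromℕ-unbounded p@(mkℚ n d-1 _) = K , subst (p <_) (sym (fromℕ-mkℚ K))
    (ℚ.*<* (subst₂ ℤ._<_ (sym (ℤₚ.*-identityʳ n)) (ℤₚ.pos-* K (suc d-1))
      (ℤₚ.<-≤-trans (n<1+∣n∣ n) (ℤ.+≤+ (ℕₚ.m≤m*n K (suc d-1))))))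
    where
    K = suc ℤ.∣ n ∣
    n<1+∣n∣ : ∀ z → z ℤ.< + suc ℤ.∣ z ∣
    n<1+∣n∣ (+ n)    = ℤ.+<+ ℕₚ.≤-refl
    n<1+∣n∣ -[1+ n ] = ℤ.-<+

  archimedean : ∀ p ε → 0ℚ < ε → Σ ℕ λ K → p < fromℕ K * ε
  archimedean p ε ε>0 = K , subst (_< fromℕ K * ε) p/ε*ε≡p (ℚₚ.*-monoˡ-<-pos ε {{ℚ.positive ε>0}} p/ε<K)
    where
    instance
      ε≢0 : ℚ.NonZero ε
      ε≢0 = ℚ.>-nonZero ε>0
    K = proj₁ (fromℕ-unbounded (p * 1/ ε))
    p/ε<K = proj₂ (fromℕ-unbounded (p * 1/ ε))
    p/ε*ε≡p : p * 1/ ε * ε ≡ p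
    p/ε*ε≡p = trans (ℚₚ.*-assoc p (1/ ε) ε) (trans (cong (p *_) (ℚₚ.*-inverseˡ ε)) (ℚₚ.*-identityʳ p))

  *-nonNeg : ∀ {p q} → 0ℚ ≤ p → 0ℚ ≤ q → 0ℚ ≤ p * q
  *-nonNeg {p} {q} p≥0 q≥0 = ℚₚ.nonNegative⁻¹ (p * q)
    {{ℚₚ.nonNeg*nonNeg⇒nonNeg p {{ℚ.nonNegative p≥0}} q {{ℚ.nonNegative q≥0}}}}

  halfPow-nonNeg : ∀ n → 0ℚ ≤ halfPow n
  halfPow-nonNeg zero    = ℚₚ.nonNegative⁻¹ 1ℚ
  halfPow-nonNeg (suc n) = *-nonNeg (ℚₚ.nonNegative⁻¹ ½) (halfPow-nonNeg n)

  p≤p+q : ∀ {p q} → 0ℚ ≤ q → p ≤ p + q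
  p≤p+q {p} {q} q≥0 = subst (_≤ p + q) (ℚₚ.+-identityʳ p) (ℚₚ.+-monoʳ-≤ p q≥0)

  sumBelow : (ℕ → ℚ) → ℕ → ℚ
  sumBelow f zero    = 0ℚ
  sumBelow f (suc n) = sumBelow f n + f n

  sumBelow-nonNeg : ∀ {f} → (∀ n → 0ℚ ≤ f n) → ∀ N → 0ℚ ≤ sumBelow f N
  sumBelow-nonNeg f≥0 zero    = ℚₚ.≤-refl
  sumBelow-nonNeg f≥0 (suc N) = ℚₚ.+-mono-≤ (sumBelow-nonNeg f≥0 N) (f≥0 N)

  sumBelow-mono : ∀ {f g} → (∀ n → f n ≤ g n) → ∀ N → sumBelow f N ≤ sumBelow g N
  sumBelow-mono f≤g zero    = ℚₚ.≤-refl
  sumBelow-mono f≤g (suc N) = ℚₚ.+-mono-≤ (sumBelow-mono f≤g N) (f≤g N)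

  term≤sumBelow : ∀ {f} → (∀ n → 0ℚ ≤ f n) → ∀ {n N} → n ℕ.< N → f n ≤ sumBelow f N
  term≤sumBelow {f} f≥0 {n} {suc N} n<1+N with ℕₚ.m≤n⇒m<n∨m≡n (ℕₚ.≤-pred n<1+N)
  ... | inj₁ n<N = ℚₚ.≤-trans (term≤sumBelow f≥0 n<N) (p≤p+q (f≥0 N))
  ... | inj₂ refl = ℚₚ.≤-trans (ℚₚ.≤-reflexive (sym (ℚₚ.+-identityˡ (f n))))
                               (ℚₚ.+-monoˡ-≤ (f n) (sumBelow-nonNeg f≥0 N))

  sumBelow-window : ∀ {f ε} → (∀ n → 0ℚ ≤ f n) → ∀ a K →
    (∀ n → a ℕ.≤ n → n ℕ.< a ℕ.+ K → ε ≤ f n) → fromℕ K * ε ≤ sumBelow f (a ℕ.+ K)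
  sumBelow-window {f} {ε} f≥0 a zero _ rewrite ℕₚ.+-identityʳ a | ℚₚ.*-zeroˡ ε = sumBelow-nonNeg f≥0 a
  sumBelow-window {f} {ε} f≥0 a (suc K) ε≤f rewrite ℕₚ.+-suc a K = begin
    fromℕ (suc K) * ε              ≡⟨ cong (_* ε) (fromℕ-+ 1 K) ⟩
    (1ℚ + fromℕ K) * ε             ≡⟨ solve 2 (λ k e → (con 1ℚ :+ k) :* e := k :* e :+ e) refl (fromℕ K) ε ⟩
    fromℕ K * ε + ε                ≤⟨ ℚₚ.+-mono-≤ (sumBelow-window f≥0 a K ε≤f′)
                                                   (ε≤f (a ℕ.+ K) (ℕₚ.m≤m+n a K) ℕₚ.≤-refl) ⟩
    sumBelow f (a ℕ.+ K) + f (a ℕ.+ K) ∎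
    where
    open ℚₚ.≤-Reasoning
    ε≤f′ : ∀ n → a ℕ.≤ n → n ℕ.< a ℕ.+ K → ε ≤ f n
    ε≤f′ n a≤n n<a+K = ε≤f n a≤n (ℕₚ.m<n⇒m<1+n n<a+K)

  TendsToZero : (ℕ → ℚ) → Set
  TendsToZero s = ∀ ε → 0ℚ < ε → Σ ℕ λ K → ∀ M → K ℕ.≤ M → ∣ s M ∣ < ε

  p≤∣p∣ : ∀ p → p ≤ ∣ p ∣
  p≤∣p∣ p with ℚₚ.≤-total 0ℚ p
  ... | inj₁ 0≤p = ℚₚ.≤-reflexive (sym (ℚₚ.0≤p⇒∣p∣≡p 0≤p))
  ... | inj₂ p≤0 = ℚₚ.≤-trans p≤0 (ℚₚ.0≤∣p∣ p)

  -p≤∣p∣ : ∀ p → - p ≤ ∣ p ∣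
  -p≤∣p∣ p = subst (- p ≤_) (ℚₚ.∣-p∣≡∣p∣ p) (p≤∣p∣ (- p))

  p≤0⇒∣p∣≡-p : ∀ {p} → p ≤ 0ℚ → ∣ p ∣ ≡ - p
  p≤0⇒∣p∣≡-p {p} p≤0 = trans (sym (ℚₚ.∣-p∣≡∣p∣ p)) (ℚₚ.0≤p⇒∣p∣≡p (ℚₚ.neg-antimono-≤ p≤0))

  -- If ∣ s M ∣ ≥ ε then, s being increasing, ∣ s n ∣ ≥ ε on a whole window of
  -- length K: after M when s M ≥ 0, before M when s M ≤ 0.
  increasing∧summable⇒tendsToZero : ∀ s B → (∀ n → s n ≤ s (suc n)) →
    (∀ N → sumBelow (λ n → ∣ s n ∣) N ≤ B) → TendsToZero s
  increasing∧summable⇒tendsToZero s B s-step Σ∣s∣≤B ε ε>0 = K , small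
    where
    open ℚₚ.≤-Reasoning
    K = proj₁ (archimedean B ε ε>0)
    B<Kε = proj₂ (archimedean B ε ε>0)

    increasing : ∀ {m n} → m ℕ.≤ n → s m ≤ s n
    increasing m≤n = go (ℕₚ.≤⇒≤′ m≤n)
      where
      go : ∀ {m n} → m ℕ.≤′ n → s m ≤ s n
      go (ℕ.≤′-reflexive refl) = ℚₚ.≤-refl
      go (ℕ.≤′-step m≤′n)      = ℚₚ.≤-trans (go m≤′n) (s-step _)

    no-window : ∀ a → (∀ n → a ℕ.≤ n → n ℕ.< a ℕ.+ K → ε ≤ ∣ s n ∣) → ⊥
    no-window a ε≤∣s∣ = ℚₚ.<-irrefl refl (ℚₚ.<-≤-trans B<Kε
      (ℚₚ.≤-trans (sumBelow-window (λ n → ℚₚ.0≤∣p∣ (s n)) a K ε≤∣s∣) (Σ∣s∣≤B (a ℕ.+ K))))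

    small : ∀ M → K ℕ.≤ M → ∣ s M ∣ < ε
    small M K≤M with ∣ s M ∣ <? ε
    ... | yes ∣sM∣<ε = ∣sM∣<ε
    ... | no ∣sM∣≮ε with ℚₚ.≤-total 0ℚ (s M)
    ...   | inj₁ 0≤sM = ⊥-elim (no-window M λ n M≤n _ → begin
              ε       ≤⟨ ℚₚ.≮⇒≥ ∣sM∣≮ε ⟩
              ∣ s M ∣ ≡⟨ ℚₚ.0≤p⇒∣p∣≡p 0≤sM ⟩
              s M     ≤⟨ increasing M≤n ⟩
              s n     ≤⟨ p≤∣p∣ (s n) ⟩
              ∣ s n ∣ ∎)
    ...   | inj₂ sM≤0 = ⊥-elim (no-window 0 λ n _ n<K → begin
              ε       ≤⟨ ℚₚ.≮⇒≥ ∣sM∣≮ε ⟩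
              ∣ s M ∣ ≡⟨ p≤0⇒∣p∣≡-p sM≤0 ⟩
              - s M   ≤⟨ ℚₚ.neg-antimono-≤ (increasing (ℕₚ.≤-trans (ℕₚ.<⇒≤ n<K) K≤M)) ⟩
              - s n   ≤⟨ -p≤∣p∣ (s n) ⟩
              ∣ s n ∣ ∎)

InQuadrant : Point → Set
InQuadrant P = inQuadrant P ≡ true

onQuadrant : {A : Set} → A → (Point → A) → Point → A
onQuadrant ε f P = if inQuadrant P then f P else ε

neighbourSum : {A : Set} → (A → A → A) → A → List Point → (Point → A) → Point → A
neighbourSum _⊕_ ε []      f P = ε
neighbourSum _⊕_ ε (s ∷ L) f P = onQuadrant ε f (P +ᵖ s) ⊕ neighbourSum _⊕_ ε L f P

neighbourSum-rel : {A B : Set} {_⊕_ : A → A → A} {_⊛_ : B → B → B} {ε : A} {ε′ : B}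
  (R : A → B → Set) → R ε ε′ → (∀ {a b c d} → R a b → R c d → R (a ⊕ c) (b ⊛ d)) →
  ∀ L {f g} P → (∀ P → InQuadrant P → R (f P) (g P)) →
  R (neighbourSum _⊕_ ε L f P) (neighbourSum _⊛_ ε′ L g P)
neighbourSum-rel R Rε R⊕ []      P fRg = Rε
neighbourSum-rel {ε = ε} {ε′} R Rε R⊕ (s ∷ L) {f} {g} P fRg =
  R⊕ (onQuadrant-rel (P +ᵖ s)) (neighbourSum-rel R Rε R⊕ L P fRg)
  where
  onQuadrant-rel : ∀ P → R (onQuadrant ε f P) (onQuadrant ε′ g P)
  onQuadrant-rel P with inQuadrant P in P∈ℕ²
  ... | true  = fRg P P∈ℕ²
  ... | false = Rε

neighbourSum-homo : {A B : Set} {_⊕_ : A → A → A} {_⊛_ : B → B → B} {ε : A} {ε′ : B}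
  (h : A → B) → h ε ≡ ε′ → (∀ a c → h (a ⊕ c) ≡ h a ⊛ h c) → ∀ L f P →
  h (neighbourSum _⊕_ ε L f P) ≡ neighbourSum _⊛_ ε′ L (h ∘ f) P
neighbourSum-homo {_⊛_ = _⊛_} h hε h⊕ L f P =
  neighbourSum-rel (λ a b → h a ≡ b) hε (λ {a} {_} {c} p q → trans (h⊕ a c) (cong₂ _⊛_ p q)) L P (λ _ _ → refl)

module Walks where

  open import Data.Nat using (_+_)

  walksFrom : List Point → Point → ℕ → Point → ℕ
  walksFrom L Q n P = length (filter (λ w → T? (validFrom P Q w)) (sequences L n))

  private
    length-filter-map∷ : (p : List Point → Bool) (s : Point) (ws : List (List Point)) →
      length (filter (T? ∘ p) (map (s ∷_) ws)) ≡ length (filter (T? ∘ p ∘ (s ∷_)) ws)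
    length-filter-map∷ p s []       = refl
    length-filter-map∷ p s (w ∷ ws) with p (s ∷ w)
    ... | true  = cong suc (length-filter-map∷ p s ws)
    ... | false = length-filter-map∷ p s ws

    length-filter-false : (ws : List (List Point)) → length (filter (λ _ → T? false) ws) ≡ 0
    length-filter-false []       = refl
    length-filter-false (w ∷ ws) = length-filter-false ws

    walksFrom-prefix : ∀ L Q n P s →
      length (filter (T? ∘ validFrom P Q) (map (s ∷_) (sequences L n)))
        ≡ (if inQuadrant (P +ᵖ s) then walksFrom L Q n (P +ᵖ s) else 0)
    walksFrom-prefix L Q n P s with inQuadrant (P +ᵖ s) | length-filter-map∷ (validFrom P Q) s (sequences L n)
    ... | true  | eq = eq
    ... | false | eq = trans eq (length-filter-false (sequences L n))

  walksFrom-zero : ∀ L Q P → walksFrom L Q 0 P ≡ (if eqPoint P Q then 1 else 0)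
  walksFrom-zero L Q P with eqPoint P Q
  ... | true  = refl
  ... | false = refl

  walksFrom-suc : ∀ L Q n P → walksFrom L Q (suc n) P ≡ neighbourSum _+_ 0 L (walksFrom L Q n) P
  walksFrom-suc L Q n P = go L
    where
    valid = T? ∘ validFrom P Q
    go : ∀ L′ → length (filter valid (concatMap (λ s → map (s ∷_) (sequences L n)) L′))
                ≡ neighbourSum _+_ 0 L′ (walksFrom L Q n) P
    go []       = refl
    go (s ∷ L′) = trans (cong length (filter-++ valid (map (s ∷_) (sequences L n)) _))
      (trans (length-++ (filter valid (map (s ∷_) (sequences L n))))
             (cong₂ _+_ (walksFrom-prefix L Q n P s) (go L′)))

module Transfer where

  open Rationals
  open import Data.Rational using (_+_; _-_; -_; _*_; _≤_)
  open import Algebra.Bundles using (CommutativeMonoid)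
  open import Algebra.Properties.CommutativeSemigroup
    (CommutativeMonoid.commutativeSemigroup ℚₚ.+-0-commutativeMonoid) using (interchange)

  neighbourSumℚ : List Point → (Point → ℚ) → Point → ℚ
  neighbourSumℚ = neighbourSum _+_ 0ℚ

  transfer : List Point → (Point → ℚ) → Point → ℚ
  transfer L f P = ½ * neighbourSumℚ L f P

  neighbourSumℚ-+ : ∀ L f g P →
    neighbourSumℚ L (λ R → f R + g R) P ≡ neighbourSumℚ L f P + neighbourSumℚ L g P
  neighbourSumℚ-+ []      f g P = refl
  neighbourSumℚ-+ (s ∷ L) f g P =
    trans (cong₂ _+_ (onQuadrant-+ (P +ᵖ s)) (neighbourSumℚ-+ L f g P))
      (interchange (onQuadrant 0ℚ f (P +ᵖ s)) (onQuadrant 0ℚ g (P +ᵖ s)) (neighbourSumℚ L f P) (neighbourSumℚ L g P))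
    where
    onQuadrant-+ : ∀ R → onQuadrant 0ℚ (λ R → f R + g R) R ≡ onQuadrant 0ℚ f R + onQuadrant 0ℚ g R
    onQuadrant-+ R with inQuadrant R
    ... | true  = refl
    ... | false = refl

  neighbourSumℚ-zero : ∀ L P → neighbourSumℚ L (λ _ → 0ℚ) P ≡ 0ℚ
  neighbourSumℚ-zero L P =
    sym (neighbourSum-homo {_⊕_ = _+_} {_+_} {0ℚ} (λ _ → 0ℚ) refl (λ _ _ → refl) L (λ _ → 0ℚ) P)

  neighbourSum-fromℕ-* : ∀ L g x P →
    neighbourSumℚ L (λ R → fromℕ (g R) * x) P ≡ fromℕ (neighbourSum ℕ._+_ 0 L g P) * x
  neighbourSum-fromℕ-* L g x P = sym (neighbourSum-homo (λ n → fromℕ n * x) (ℚₚ.*-zeroˡ x)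
    (λ m n → trans (cong (_* x) (fromℕ-+ m n)) (ℚₚ.*-distribʳ-+ x (fromℕ m) (fromℕ n))) L g P)

  transfer-+ : ∀ L f g P → transfer L (λ R → f R + g R) P ≡ transfer L f P + transfer L g P
  transfer-+ L f g P =
    trans (cong (½ *_) (neighbourSumℚ-+ L f g P)) (ℚₚ.*-distribˡ-+ ½ (neighbourSumℚ L f P) (neighbourSumℚ L g P))

  transfer-neg : ∀ L f P → transfer L (-_ ∘ f) P ≡ - transfer L f P
  transfer-neg L f P = trans (cong (½ *_) (sym (neighbourSum-homo -_ refl ℚₚ.neg-distrib-+ L f P)))
                             (sym (ℚₚ.neg-distribʳ-* ½ (neighbourSumℚ L f P)))

  transfer-- : ∀ L f g P → transfer L (λ R → f R - g R) P ≡ transfer L f P - transfer L g P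
  transfer-- L f g P = trans (transfer-+ L f (-_ ∘ g) P) (cong (_+_ (transfer L f P)) (transfer-neg L g P))

  transfer-mono : ∀ L {f g} P → (∀ R → InQuadrant R → f R ≤ g R) → transfer L f P ≤ transfer L g P
  transfer-mono L P f≤g = ℚₚ.*-monoˡ-≤-nonNeg ½ (neighbourSum-rel _≤_ ℚₚ.≤-refl ℚₚ.+-mono-≤ L P f≤g)

  ∣transfer∣≤transfer∣∣ : ∀ L f P → ∣ transfer L f P ∣ ≤ transfer L (∣_∣ ∘ f) P
  ∣transfer∣≤transfer∣∣ L f P rewrite ℚₚ.∣p*q∣≡∣p∣*∣q∣ ½ (neighbourSumℚ L f P) =
    ℚₚ.*-monoˡ-≤-nonNeg ½ (neighbourSum-rel (λ a b → ∣ a ∣ ≤ b) ℚₚ.≤-refl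
      (λ {a} {_} {c} ∣a∣≤b ∣c∣≤d → ℚₚ.≤-trans (ℚₚ.∣p+q∣≤∣p∣+∣q∣ a c) (ℚₚ.+-mono-≤ ∣a∣≤b ∣c∣≤d))
      L P (λ _ _ → ℚₚ.≤-refl))

module Convergence (L : List Point) (Q : Point) where

  open Rationals
  open Transfer
  open Walks using (walksFrom; walksFrom-zero; walksFrom-suc)
  open import Data.Rational using (_+_; _-_; -_; _*_; _≤_)
  open import Data.Rational.Solver using (module +-*-Solver)
  open +-*-Solver

  δ : Point → ℚ
  δ P = if eqPoint P Q then 1ℚ else 0ℚ

  partialSumFrom : ℕ → Point → ℚ
  partialSumFrom zero    P = 0ℚ
  partialSumFrom (suc M) P = partialSumFrom M P + fromℕ (walksFrom L Q M P) * halfPow M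

  partialSumFrom-suc : ∀ M P → partialSumFrom (suc M) P ≡ δ P + transfer L (partialSumFrom M) P
  partialSumFrom-suc zero P rewrite neighbourSumℚ-zero L P | walksFrom-zero L Q P with eqPoint P Q
  ... | true  = refl
  ... | false = refl
  partialSumFrom-suc (suc M) P = begin
    partialSumFrom (suc M) P + fromℕ (walksFrom L Q (suc M) P) * (½ * h)
      ≡⟨ cong₂ (λ a n → a + fromℕ n * (½ * h)) (partialSumFrom-suc M P) (walksFrom-suc L Q M P) ⟩
    (δ P + ½ * Σs) + fromℕ (neighbourSum ℕ._+_ 0 L (walksFrom L Q M) P) * (½ * h)
      ≡⟨ solve 5 (λ d s w x y → (d :+ x :* s) :+ w :* (x :* y) := d :+ x :* (s :+ w :* y))
               refl (δ P) Σs (fromℕ (neighbourSum ℕ._+_ 0 L (walksFrom L Q M) P)) ½ h ⟩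
    δ P + ½ * (Σs + fromℕ (neighbourSum ℕ._+_ 0 L (walksFrom L Q M) P) * h)
      ≡⟨ cong (λ x → δ P + ½ * (Σs + x)) (sym (neighbourSum-fromℕ-* L (walksFrom L Q M) h P)) ⟩
    δ P + ½ * (Σs + neighbourSumℚ L (λ R → fromℕ (walksFrom L Q M R) * h) P)
      ≡⟨ cong (λ x → δ P + ½ * x) (sym (neighbourSumℚ-+ L (partialSumFrom M) _ P)) ⟩
    δ P + transfer L (partialSumFrom (suc M)) P ∎
    where
    open ≡-Reasoning
    h = halfPow M
    Σs = neighbourSumℚ L (partialSumFrom M) P

  module _ (G v : Point → ℚ)
           (G-fixed : ∀ P → InQuadrant P → G P ≡ δ P + transfer L G P)
           (v-nonNeg : ∀ P → InQuadrant P → 0ℚ ≤ v P)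
           (v-super : ∀ P → InQuadrant P → ∣ G P ∣ + transfer L v P ≤ v P) where

    err : ℕ → Point → ℚ
    err M P = partialSumFrom M P - G P

    err-suc : ∀ M P → InQuadrant P → err (suc M) P ≡ transfer L (err M) P
    err-suc M P P∈ℕ² = begin
      partialSumFrom (suc M) P - G P
        ≡⟨ cong₂ _-_ (partialSumFrom-suc M P) (G-fixed P P∈ℕ²) ⟩
      (δ P + transfer L (partialSumFrom M) P) - (δ P + transfer L G P)
        ≡⟨ solve 3 (λ d a b → (d :+ a) :- (d :+ b) := a :- b) refl (δ P) _ _ ⟩
      transfer L (partialSumFrom M) P - transfer L G P
        ≡⟨ sym (transfer-- L (partialSumFrom M) G P) ⟩
      transfer L (err M) P ∎
      where open ≡-Reasoning

    err-increasing : ∀ M P → err M P ≤ err (suc M) P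
    err-increasing M P = ℚₚ.+-monoˡ-≤ (- G P)
      (p≤p+q {partialSumFrom M P} (*-nonNeg (fromℕ-nonNeg (walksFrom L Q M P)) (halfPow-nonNeg M)))

    errBound : ℕ → Point → ℚ
    errBound zero    P = ∣ G P ∣
    errBound (suc n) P = transfer L (errBound n) P

    ∣err∣≤errBound : ∀ M P → InQuadrant P → ∣ err M P ∣ ≤ errBound M P
    ∣err∣≤errBound zero    P _    = ℚₚ.≤-reflexive (trans (cong ∣_∣ (ℚₚ.+-identityˡ (- G P))) (ℚₚ.∣-p∣≡∣p∣ (G P)))
    ∣err∣≤errBound (suc M) P P∈ℕ² = subst (λ x → ∣ x ∣ ≤ errBound (suc M) P) (sym (err-suc M P P∈ℕ²))
      (ℚₚ.≤-trans (∣transfer∣≤transfer∣∣ L (err M) P) (transfer-mono L P (∣err∣≤errBound M)))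

    errBoundSum : ℕ → Point → ℚ
    errBoundSum N P = sumBelow (λ n → errBound n P) N

    errBoundSum-suc : ∀ N P → errBoundSum (suc N) P ≡ ∣ G P ∣ + transfer L (errBoundSum N) P
    errBoundSum-suc zero    P = begin
      0ℚ + ∣ G P ∣                               ≡⟨ ℚₚ.+-identityˡ ∣ G P ∣ ⟩
      ∣ G P ∣                                    ≡⟨ sym (ℚₚ.+-identityʳ ∣ G P ∣) ⟩
      ∣ G P ∣ + 0ℚ                               ≡⟨ cong (λ x → ∣ G P ∣ + x) (sym (ℚₚ.*-zeroʳ ½)) ⟩
      ∣ G P ∣ + ½ * 0ℚ                           ≡⟨ cong (λ x → ∣ G P ∣ + ½ * x) (sym (neighbourSumℚ-zero L P)) ⟩
      ∣ G P ∣ + transfer L (errBoundSum zero) P ∎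
      where open ≡-Reasoning
    errBoundSum-suc (suc N) P = begin
      errBoundSum (suc N) P + transfer L (errBound N) P
        ≡⟨ cong (_+ transfer L (errBound N) P) (errBoundSum-suc N P) ⟩
      (∣ G P ∣ + transfer L (errBoundSum N) P) + transfer L (errBound N) P
        ≡⟨ ℚₚ.+-assoc ∣ G P ∣ (transfer L (errBoundSum N) P) (transfer L (errBound N) P) ⟩
      ∣ G P ∣ + (transfer L (errBoundSum N) P + transfer L (errBound N) P)
        ≡⟨ cong (_+_ ∣ G P ∣) (sym (transfer-+ L (errBoundSum N) (errBound N) P)) ⟩
      ∣ G P ∣ + transfer L (errBoundSum (suc N)) P ∎
      where open ≡-Reasoning

    errBoundSum≤v : ∀ N P → InQuadrant P → errBoundSum N P ≤ v P
    errBoundSum≤v zero    P P∈ℕ² = v-nonNeg P P∈ℕ²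
    errBoundSum≤v (suc N) P P∈ℕ² = subst (_≤ v P) (sym (errBoundSum-suc N P))
      (ℚₚ.≤-trans (ℚₚ.+-monoʳ-≤ ∣ G P ∣ (transfer-mono L P (errBoundSum≤v N))) (v-super P P∈ℕ²))

    partialSumFrom-converges : ∀ O → InQuadrant O → PartialSumsConvergeTo (λ M → partialSumFrom M O) (G O)
    partialSumFrom-converges O O∈ℕ² =
      increasing∧summable⇒tendsToZero (λ M → err M O) (v O) (λ M → err-increasing M O)
        (λ N → ℚₚ.≤-trans (sumBelow-mono (λ n → ∣err∣≤errBound n O O∈ℕ²) N) (errBoundSum≤v N O O∈ℕ²))

partialSum≡partialSumFrom : ∀ S Q M → partialSum S Q M ≡ Convergence.partialSumFrom (steps S) Q M (0ℤ , 0ℤ)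
partialSum≡partialSumFrom S Q zero    = refl
partialSum≡partialSumFrom S Q (suc M) =
  cong (ℚ._+ (+ countWalks S M Q ℚ./ 1) ℚ.* halfPow M) (partialSum≡partialSumFrom S Q M)

PartialSumsConvergeTo-cong : ∀ {s t q} → (∀ M → s M ≡ t M) → PartialSumsConvergeTo s q → PartialSumsConvergeTo t q
PartialSumsConvergeTo-cong {q = q} s≡t s→q ε ε>0 = proj₁ (s→q ε ε>0) , λ M K≤M →
  subst (λ x → ∣ x ℚ.- q ∣ ℚ.< ε) (s≡t M) (proj₂ (s→q ε ε>0) M K≤M)

module Lattice where

  open Transfer using (transfer)
  open import Data.Rational using (_+_; _*_)
  open import Data.List.Relation.Binary.Sublist.Propositional using (_⊆_; []; _∷_; _∷ʳ_)
  open import Data.Rational.Solver using (module +-*-Solver)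
  open +-*-Solver

  extend : {A : Set} → A → (ℕ → ℕ → A) → Point → A
  extend ε h (+ i , + j)      = h i j
  extend ε h (+ i , -[1+ j ]) = ε
  extend ε h (-[1+ i ] , b)   = ε

  atNW atSE : {A : Set} → A → (ℕ → ℕ → A) → ℕ → ℕ → A
  atNW ε h zero    j       = ε
  atNW ε h (suc i) j       = h i (suc j)
  atSE ε h i       zero    = ε
  atSE ε h i       (suc j) = h (suc i) j

  stepSum : {A : Set} → StepSet → (A → A → A) → A → (nw n ne e se : A) → A
  stepSum 𝒜 _⊕_ ε nw n ne e se = nw ⊕ (ne ⊕ (se ⊕ ε))
  stepSum ℬ _⊕_ ε nw n ne e se = nw ⊕ (n ⊕ (e ⊕ (se ⊕ ε)))
  stepSum 𝒞 _⊕_ ε nw n ne e se = nw ⊕ (n ⊕ (ne ⊕ (e ⊕ (se ⊕ ε))))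
  stepSum 𝒟 _⊕_ ε nw n ne e se = nw ⊕ (n ⊕ (se ⊕ ε))
  stepSum ℰ _⊕_ ε nw n ne e se = nw ⊕ (n ⊕ (ne ⊕ (se ⊕ ε)))

  module _ {A : Set} (_⊕_ : A → A → A) (ε : A) (h : ℕ → ℕ → A) where

    private
      at : ℕ → ℕ → Point → A
      at i j s = onQuadrant ε (extend ε h) ((+ i , + j) +ᵖ s)

      at-N : ∀ i j → at i j N ≡ h i (suc j)
      at-N i j = cong₂ h (ℕₚ.+-identityʳ i) (ℕₚ.+-comm j 1)

      at-E : ∀ i j → at i j E ≡ h (suc i) j
      at-E i j = cong₂ h (ℕₚ.+-comm i 1) (ℕₚ.+-identityʳ j)

      at-NE : ∀ i j → at i j NE ≡ h (suc i) (suc j)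
      at-NE i j = cong₂ h (ℕₚ.+-comm i 1) (ℕₚ.+-comm j 1)

      at-NW : ∀ i j → at i j NW ≡ atNW ε h i j
      at-NW zero    j = refl
      at-NW (suc i) j = cong (h i) (ℕₚ.+-comm j 1)

      at-SE : ∀ i j → at i j SE ≡ atSE ε h i j
      at-SE i zero    = refl
      at-SE i (suc j) = cong (λ a → h a j) (ℕₚ.+-comm i 1)

    neighbourSum-extend : ∀ S i j → neighbourSum _⊕_ ε (steps S) (extend ε h) (+ i , + j)
      ≡ stepSum S _⊕_ ε (atNW ε h i j) (h i (suc j)) (h (suc i) (suc j)) (h (suc i) j) (atSE ε h i j)
    neighbourSum-extend 𝒜 i j =
      cong₂ _⊕_ (at-NW i j) (cong₂ _⊕_ (at-NE i j) (cong₂ _⊕_ (at-SE i j) refl))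
    neighbourSum-extend ℬ i j =
      cong₂ _⊕_ (at-NW i j) (cong₂ _⊕_ (at-N i j) (cong₂ _⊕_ (at-E i j) (cong₂ _⊕_ (at-SE i j) refl)))
    neighbourSum-extend 𝒞 i j =
      cong₂ _⊕_ (at-NW i j) (cong₂ _⊕_ (at-N i j)
        (cong₂ _⊕_ (at-NE i j) (cong₂ _⊕_ (at-E i j) (cong₂ _⊕_ (at-SE i j) refl))))
    neighbourSum-extend 𝒟 i j =
      cong₂ _⊕_ (at-NW i j) (cong₂ _⊕_ (at-N i j) (cong₂ _⊕_ (at-SE i j) refl))
    neighbourSum-extend ℰ i j =
      cong₂ _⊕_ (at-NW i j) (cong₂ _⊕_ (at-N i j) (cong₂ _⊕_ (at-NE i j) (cong₂ _⊕_ (at-SE i j) refl)))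

  raisingSum : StepSet → (n ne e : ℚ) → ℚ
  raisingSum 𝒜 n ne e = ne
  raisingSum ℬ n ne e = n + e
  raisingSum 𝒞 n ne e = n + (ne + e)
  raisingSum 𝒟 n ne e = n
  raisingSum ℰ n ne e = n + ne

  stepSum-split : ∀ S nw n ne e se → stepSum S _+_ 0ℚ nw n ne e se ≡ raisingSum S n ne e + (nw + se)
  stepSum-split 𝒜 nw n ne e se =
    solve 3 (λ nw ne se → nw :+ (ne :+ (se :+ con 0ℚ)) := ne :+ (nw :+ se)) refl nw ne se
  stepSum-split ℬ nw n ne e se =
    solve 4 (λ nw n e se → nw :+ (n :+ (e :+ (se :+ con 0ℚ))) := (n :+ e) :+ (nw :+ se)) refl nw n e se
  stepSum-split 𝒞 nw n ne e se =
    solve 5 (λ nw n ne e se → nw :+ (n :+ (ne :+ (e :+ (se :+ con 0ℚ)))) := (n :+ (ne :+ e)) :+ (nw :+ se))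
      refl nw n ne e se
  stepSum-split 𝒟 nw n ne e se =
    solve 3 (λ nw n se → nw :+ (n :+ (se :+ con 0ℚ)) := n :+ (nw :+ se)) refl nw n se
  stepSum-split ℰ nw n ne e se =
    solve 4 (λ nw n ne se → nw :+ (n :+ (ne :+ (se :+ con 0ℚ))) := (n :+ ne) :+ (nw :+ se)) refl nw n ne se

  transfer-extend : ∀ S h i j → transfer (steps S) (extend 0ℚ h) (+ i , + j)
    ≡ ½ * (raisingSum S (h i (suc j)) (h (suc i) (suc j)) (h (suc i) j) + (atNW 0ℚ h i j + atSE 0ℚ h i j))
  transfer-extend S h i j = cong (½ *_) (trans (neighbourSum-extend _+_ 0ℚ h S i j) (stepSum-split S _ _ _ _ _))

  steps⊆steps𝒞 : ∀ S → steps S ⊆ steps 𝒞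
  steps⊆steps𝒞 𝒜 = refl ∷ (N ∷ʳ (refl ∷ (E ∷ʳ (refl ∷ []))))
  steps⊆steps𝒞 ℬ = refl ∷ (refl ∷ (NE ∷ʳ (refl ∷ (refl ∷ []))))
  steps⊆steps𝒞 𝒞 = refl ∷ (refl ∷ (refl ∷ (refl ∷ (refl ∷ []))))
  steps⊆steps𝒞 𝒟 = refl ∷ (refl ∷ (NE ∷ʳ (E ∷ʳ (refl ∷ []))))
  steps⊆steps𝒞 ℰ = refl ∷ (refl ∷ (refl ∷ (E ∷ʳ (refl ∷ []))))

  neighbourSum-mono-⊆ : ∀ {L L′} → L ⊆ L′ → ∀ f P →
    neighbourSum ℕ._+_ 0 L f P ℕ.≤ neighbourSum ℕ._+_ 0 L′ f P
  neighbourSum-mono-⊆ []          f P = ℕ.z≤n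
  neighbourSum-mono-⊆ (s ∷ʳ L⊆L′) f P = ℕₚ.≤-trans (neighbourSum-mono-⊆ L⊆L′ f P) (ℕₚ.m≤n+m _ _)
  neighbourSum-mono-⊆ (refl ∷ L⊆L′) f P = ℕₚ.+-monoʳ-≤ _ (neighbourSum-mono-⊆ L⊆L′ f P)

module Segment where

  open Rationals
  open import Data.Rational using (_+_; _-_; -_; _*_; 1/_)
  open import Data.Rational.Solver using (module +-*-Solver)
  open +-*-Solver

  prev : (ℕ → ℚ) → ℕ → ℚ
  prev x zero    = 0ℚ
  prev x (suc i) = x i

  -- Shooting: α solves x (i + 1) = 2 x i - x (i - 1) - 2 β i with x (-1) = x 0 = 0,
  -- and adding t times the homogeneous solution i + 1 adjusts the right end to 0.
  module _ (m : ℕ) (β : ℕ → ℚ) where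

    private
      α : ℕ → ℚ
      α zero          = 0ℚ
      α (suc zero)    = - (β 0 + β 0)
      α (suc (suc i)) = (α (suc i) + α (suc i)) - α i - (β (suc i) + β (suc i))

      instance
        m+2≢0 : ℚ.NonZero (fromℕ (suc (suc m)))
        m+2≢0 = ℚ.>-nonZero (fromℕ-pos (suc m))

      t : ℚ
      t = - α (suc m) * 1/ fromℕ (suc (suc m))

    dirichlet : ℕ → ℚ
    dirichlet i = α i + fromℕ (suc i) * t

    dirichlet-eq : ∀ i → dirichlet i ≡ β i + ½ * (prev dirichlet i + dirichlet (suc i))
    dirichlet-eq zero = solve 2 (λ b t → con 0ℚ :+ con 1ℚ :* t
                                        := b :+ con ½ :* (con 0ℚ :+ (:- (b :+ b) :+ (con 1ℚ :+ con 1ℚ) :* t)))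
                          refl (β 0) t
    dirichlet-eq (suc i) = begin
      α (suc i) + fromℕ (suc (suc i)) * t
        ≡⟨ cong (λ x → α (suc i) + x * t) (fromℕ-+ 1 (suc i)) ⟩
      α (suc i) + (1ℚ + g) * t
        ≡⟨ solve 5 (λ a₁ a₀ b g t → a₁ :+ (con 1ℚ :+ g) :* t
                   := b :+ con ½ :* ((a₀ :+ g :* t)
                        :+ (((a₁ :+ a₁) :- a₀ :- (b :+ b)) :+ (con 1ℚ :+ (con 1ℚ :+ g)) :* t)))
                 refl (α (suc i)) (α i) (β (suc i)) g t ⟩
      β (suc i) + ½ * ((α i + g * t) + (α (suc (suc i)) + (1ℚ + (1ℚ + g)) * t))
        ≡⟨ cong (λ x → β (suc i) + ½ * ((α i + g * t) + (α (suc (suc i)) + x * t)))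
                (sym (trans (fromℕ-+ 1 (suc (suc i))) (cong (_+_ 1ℚ) (fromℕ-+ 1 (suc i))))) ⟩
      β (suc i) + ½ * (prev dirichlet (suc i) + dirichlet (suc (suc i))) ∎
      where
      open ≡-Reasoning
      g = fromℕ (suc i)

    dirichlet-boundary : dirichlet (suc m) ≡ 0ℚ
    dirichlet-boundary = begin
      a + g * (- a * 1/ g) ≡⟨ solve 3 (λ a g h → a :+ g :* ((:- a) :* h) := a :- a :* (g :* h)) refl a g (1/ g) ⟩
      a - a * (g * 1/ g)   ≡⟨ cong (λ x → a - a * x) (ℚₚ.*-inverseʳ g) ⟩
      a - a * 1ℚ           ≡⟨ solve 1 (λ a → a :- a :* con 1ℚ := con 0ℚ) refl a ⟩
      0ℚ                   ∎
      where
      open ≡-Reasoning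
      a = α (suc m)
      g = fromℕ (suc (suc m))

module Depth (k : ℕ) where

  open import Data.Nat using (_+_; _∸_; _≤_; _<_; pred)

  -- Levels i + j > k + 1 all get depth 0 because ∸ truncates.
  depth : ℕ → ℕ → ℕ
  depth i j = suc (suc k) ∸ (i + j)

  depth-sameLevel : ∀ {a b i j} → a + b ≡ i + j → depth a b ≡ depth i j
  depth-sameLevel = cong (suc (suc k) ∸_)

  depth-sucˡ : ∀ i j → depth (suc i) j ≡ pred (depth i j)
  depth-sucˡ i j = sym (ℕₚ.pred[m∸n]≡m∸[1+n] (suc (suc k)) (i + j))

  depth-sucʳ : ∀ i j → depth i (suc j) ≡ pred (depth i j)
  depth-sucʳ i j = trans (depth-sameLevel {i} {suc j} {suc i} {j} (ℕₚ.+-suc i j)) (depth-sucˡ i j)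

  depth≡0⇒outside : ∀ i j → pred (depth i j) ≡ 0 → k < i + j
  depth≡0⇒outside i j eq = ℕₚ.m∸n≡0⇒m≤n (trans (depth-sucˡ i j) eq)

  depth≡2+d⇒level : ∀ i j {d} → suc (suc d) ≡ depth i j → k ∸ d ≡ i + j
  depth≡2+d⇒level i j {d} eq = trans (cong (k ∸_) d≡k∸m) (ℕₚ.m∸[m∸n]≡n m≤k)
    where
    1+d≡1+k∸m : suc d ≡ suc k ∸ (i + j)
    1+d≡1+k∸m = trans (cong pred eq) (sym (depth-sucˡ i j))
    d≡k∸m : d ≡ k ∸ (i + j)
    d≡k∸m = trans (cong pred 1+d≡1+k∸m) (ℕₚ.pred[m∸n]≡m∸[1+n] (suc k) (i + j))
    m≤k : i + j ≤ k
    m≤k = ℕₚ.≤-pred (ℕₚ.m∸n≢0⇒n<m (ℕₚ.1+n≢0 ∘ trans 1+d≡1+k∸m))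

module FixedPoint (S : StepSet) (k : ℕ) (f : ℕ → ℕ → ℚ) where

  open Depth k
  open Lattice using (raisingSum; atNW; atSE)
  open Segment
  open import Data.Nat using (_∸_; _<_; pred)
  open import Data.Rational using (_+_; _*_)
  open import Data.Rational.Solver using (module +-*-Solver)
  open +-*-Solver

  levelSource : ℕ → (above above² : ℕ → ℚ) → ℕ → ℚ
  levelSource d above above² a = f a (k ∸ d ∸ a) + ½ * raisingSum S (above a) (above² (suc a)) (above (suc a))

  -- level (2 + d) i is the value at (i, k - d - i) on the level i + j = k - d;
  -- level 0 and level 1 stand for the levels above k, where the solution vanishes.
  level : ℕ → ℕ → ℚ
  level zero          i = 0ℚ
  level (suc zero)    i = 0ℚ
  level (suc (suc d)) i = dirichlet (k ∸ d) (levelSource d (level (suc d)) (level d)) i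

  solution : ℕ → ℕ → ℚ
  solution i j = level (depth i j) i

  private
    dirichlet-SE : ∀ m β i j → m ≡ i ℕ.+ j → dirichlet m β (suc i) ≡ atSE 0ℚ (const ∘ dirichlet m β) i j
    dirichlet-SE m β i zero    m≡i+0 =
      trans (cong (λ n → dirichlet m β (suc n)) (sym (trans m≡i+0 (ℕₚ.+-identityʳ i)))) (dirichlet-boundary m β)
    dirichlet-SE m β i (suc j) _     = refl

    atNW-solution : ∀ i j → atNW 0ℚ solution i j ≡ prev (level (depth i j)) i
    atNW-solution zero    j = refl
    atNW-solution (suc i) j = cong (λ D → level D i) (depth-sameLevel {i} {suc j} {suc i} {j} (ℕₚ.+-suc i j))

    atSE-solution : ∀ i j → atSE 0ℚ solution i j ≡ atSE 0ℚ (const ∘ level (depth i j)) i j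
    atSE-solution i zero    = refl
    atSE-solution i (suc j) = cong (λ D → level D (suc i)) (depth-sameLevel {suc i} {j} {i} {suc j} (sym (ℕₚ.+-suc i j)))

    raisingSum-solution : ∀ i j →
      raisingSum S (solution i (suc j)) (solution (suc i) (suc j)) (solution (suc i) j)
        ≡ raisingSum S (level (pred (depth i j)) i) (level (pred (pred (depth i j))) (suc i)) (level (pred (depth i j)) (suc i))
    raisingSum-solution i j = trans
      (cong₂ (λ n e → raisingSum S n (solution (suc i) (suc j)) e)
             (cong (λ D → level D i) (depth-sucʳ i j)) (cong (λ D → level D (suc i)) (depth-sucˡ i j)))
      (cong (λ ne → raisingSum S (level (pred (depth i j)) i) ne (level (pred (depth i j)) (suc i)))
            (cong (λ D → level D (suc i)) (trans (depth-sucˡ i (suc j)) (cong pred (depth-sucʳ i j)))))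

  module _ (f-outside : ∀ i j → k < i ℕ.+ j → f i j ≡ 0ℚ) where

    private
      regroup : ∀ a r p s → (a + ½ * r) + ½ * (p + s) ≡ a + ½ * (r + (p + s))
      regroup = solve 4 (λ a r p s → (a :+ con ½ :* r) :+ con ½ :* (p :+ s) := a :+ con ½ :* (r :+ (p :+ s))) refl

      raisingSum-zero : ∀ S → raisingSum S 0ℚ 0ℚ 0ℚ ≡ 0ℚ
      raisingSum-zero 𝒜 = refl
      raisingSum-zero ℬ = refl
      raisingSum-zero 𝒞 = refl
      raisingSum-zero 𝒟 = refl
      raisingSum-zero ℰ = refl

      prev-vanishing : ∀ x → (∀ a → x a ≡ 0ℚ) → ∀ i → prev x i ≡ 0ℚ
      prev-vanishing x x≡0 zero    = refl
      prev-vanishing x x≡0 (suc i) = x≡0 i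

      atSE-vanishing : ∀ x → (∀ a → x a ≡ 0ℚ) → ∀ i j → atSE 0ℚ (const ∘ x) i j ≡ 0ℚ
      atSE-vanishing x x≡0 i zero    = refl
      atSE-vanishing x x≡0 i (suc j) = x≡0 (suc i)

      vanishing-eq : ∀ {i j} → k < i ℕ.+ j → (x : ℕ → ℚ) → (∀ a → x a ≡ 0ℚ) →
        0ℚ ≡ f i j + ½ * (raisingSum S 0ℚ 0ℚ 0ℚ + (prev x i + atSE 0ℚ (const ∘ x) i j))
      vanishing-eq {i} {j} k<m x x≡0 = sym (cong₂ (λ a b → a + ½ * b) (f-outside i j k<m)
        (cong₂ _+_ (raisingSum-zero S) (cong₂ _+_ (prev-vanishing x x≡0 i) (atSE-vanishing x x≡0 i j))))

    level-eq : ∀ D i j → D ≡ depth i j →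
      level D i ≡ f i j + ½ * (raisingSum S (level (pred D) i) (level (pred (pred D)) (suc i)) (level (pred D) (suc i))
                               + (prev (level D) i + atSE 0ℚ (const ∘ level D) i j))
    level-eq zero          i j eq = vanishing-eq (depth≡0⇒outside i j (cong pred (sym eq))) (level 0) (λ _ → refl)
    level-eq (suc zero)    i j eq = vanishing-eq (depth≡0⇒outside i j (cong pred (sym eq))) (level 1) (λ _ → refl)
    level-eq (suc (suc d)) i j eq = begin
      x i
        ≡⟨ dirichlet-eq (k ∸ d) β i ⟩
      β i + ½ * (prev x i + x (suc i))
        ≡⟨ cong₂ (λ b y → (f i b + ½ * r) + ½ * (prev x i + y))
                 k∸d∸i≡j (dirichlet-SE (k ∸ d) β i j (depth≡2+d⇒level i j eq)) ⟩
      (f i j + ½ * r) + ½ * (prev x i + atSE 0ℚ (const ∘ x) i j)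
        ≡⟨ regroup (f i j) r (prev x i) (atSE 0ℚ (const ∘ x) i j) ⟩
      f i j + ½ * (r + (prev x i + atSE 0ℚ (const ∘ x) i j)) ∎
      where
      open ≡-Reasoning
      x = level (suc (suc d))
      β = levelSource d (level (suc d)) (level d)
      r = raisingSum S (level (suc d) i) (level d (suc i)) (level (suc d) (suc i))
      k∸d∸i≡j : k ∸ d ∸ i ≡ j
      k∸d∸i≡j = trans (cong (_∸ i) (depth≡2+d⇒level i j eq)) (ℕₚ.m+n∸m≡n i j)

    solution-eq : ∀ i j → solution i j
      ≡ f i j + ½ * (raisingSum S (solution i (suc j)) (solution (suc i) (suc j)) (solution (suc i) j)
                     + (atNW 0ℚ solution i j + atSE 0ℚ solution i j))
    solution-eq i j = trans (level-eq (depth i j) i j refl)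
      (sym (cong₂ (λ r s → f i j + ½ * (r + s))
                  (raisingSum-solution i j) (cong₂ _+_ (atNW-solution i j) (atSE-solution i j))))

module Potential (k : ℕ) where

  open Depth k
  open Lattice using (atNW; atSE)
  open import Data.Nat using (_+_; _*_; _≤_; _<_; _∸_; pred; z≤n; s≤s)
  open import Data.Nat.Tactic.RingSolver using (solve-∀)
  open ℕₚ.≤-Reasoning

  -- R bounds (i + 2) (j + 2) on the levels i + j ≤ k + 1, where W (depth i j) ≠ 0, so that
  -- a weight W D absorbs the raising neighbours, which have depth D - 1 or D - 2.
  R : ℕ
  R = (3 + k) * (3 + k)

  W : ℕ → ℕ
  W zero    = 0
  W (suc D) = suc (3 * (R * W D))

  -- (i + 1) (j + 1) is concave along each level: its NW and SE neighbours sum to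
  -- twice its value minus 2, and it vanishes just outside the quadrant.
  V : ℕ → ℕ → ℕ
  V i j = W (depth i j) * (suc i * suc j)

  private
    W-pred≤W : ∀ D → W (pred D) ≤ W D
    W-pred≤W zero    = ℕₚ.≤-refl
    W-pred≤W (suc D) = ℕₚ.m≤n⇒m≤1+n (begin
      W D           ≤⟨ ℕₚ.m≤n*m (W D) R ⟩
      R * W D       ≤⟨ ℕₚ.m≤n*m (R * W D) 3 ⟩
      3 * (R * W D) ∎)

    W-suc-dominates : ∀ D {a b c} → a ≤ R → b ≤ R → c ≤ R → W D * a + (W (pred D) * b + W D * c) < W (suc D)
    W-suc-dominates D {a} {b} {c} a≤R b≤R c≤R = s≤s (begin
      W D * a + (W (pred D) * b + W D * c) ≤⟨ ℕₚ.+-mono-≤ (ℕₚ.*-monoʳ-≤ (W D) a≤R)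
                                               (ℕₚ.+-mono-≤ (ℕₚ.*-mono-≤ (W-pred≤W D) b≤R) (ℕₚ.*-monoʳ-≤ (W D) c≤R)) ⟩
      W D * R + (W D * R + W D * R)        ≡⟨ three-copies (W D) R ⟩
      3 * (R * W D)                        ∎)
      where
      three-copies : ∀ w r → w * r + (w * r + w * r) ≡ 3 * (r * w)
      three-copies = solve-∀

  raising≤W : ∀ i j → V i (suc j) + (V (suc i) (suc j) + V (suc i) j) ≤ W (depth i j)
  raising≤W i j = subst (_≤ W (depth i j)) (sym V-raising) (bound (depth i j) refl)
    where
    a = suc i * suc (suc j)
    b = suc (suc i) * suc (suc j)
    c = suc (suc i) * suc j

    V-raising : V i (suc j) + (V (suc i) (suc j) + V (suc i) j)
              ≡ W (pred (depth i j)) * a + (W (pred (pred (depth i j))) * b + W (pred (depth i j)) * c)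
    V-raising = cong₂ _+_ (cong (λ D → W D * a) (depth-sucʳ i j))
      (cong₂ _+_ (cong (λ D → W D * b) (trans (depth-sucˡ i (suc j)) (cong pred (depth-sucʳ i j))))
                 (cong (λ D → W D * c) (depth-sucˡ i j)))

    bound : ∀ D → D ≡ depth i j → W (pred D) * a + (W (pred (pred D)) * b + W (pred D) * c) ≤ W D
    bound zero    _  = z≤n
    bound (suc D) eq = ℕₚ.<⇒≤ (W-suc-dominates D (ℕₚ.*-mono-≤ (ℕₚ.m≤n⇒m≤1+n (s≤s i≤1+k)) 2+j≤3+k)
                                            (ℕₚ.*-mono-≤ 2+i≤3+k 2+j≤3+k)
                                            (ℕₚ.*-mono-≤ 2+i≤3+k (ℕₚ.m≤n⇒m≤1+n (s≤s j≤1+k))))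
      where
      m≤1+k : i + j ≤ suc k
      m≤1+k = ℕₚ.≤-pred (ℕₚ.m∸n≢0⇒n<m (λ depth≡0 → ℕₚ.1+n≢0 (trans eq depth≡0)))
      i≤1+k = ℕₚ.≤-trans (ℕₚ.m≤m+n i j) m≤1+k
      j≤1+k = ℕₚ.≤-trans (ℕₚ.m≤n+m j i) m≤1+k
      2+i≤3+k = s≤s (s≤s i≤1+k)
      2+j≤3+k = s≤s (s≤s j≤1+k)

  private
    atNW-V : ∀ i j → atNW 0 V i j ≡ W (depth i j) * (i * (2 + j))
    atNW-V zero    j = sym (ℕₚ.*-zeroʳ (W (depth 0 j)))
    atNW-V (suc i) j = cong (λ D → W D * (suc i * (2 + j))) (depth-sameLevel {i} {suc j} {suc i} {j} (ℕₚ.+-suc i j))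

    atSE-V : ∀ i j → atSE 0 V i j ≡ W (depth i j) * ((2 + i) * j)
    atSE-V i zero    = sym (trans (cong (W (depth i 0) *_) (ℕₚ.*-zeroʳ (2 + i))) (ℕₚ.*-zeroʳ (W (depth i 0))))
    atSE-V i (suc j) = cong (λ D → W D * ((2 + i) * suc j)) (depth-sameLevel {suc i} {j} {i} {suc j} (sym (ℕₚ.+-suc i j)))

    regroup : ∀ w nw n ne e se → w + (nw + (n + (ne + (e + (se + 0))))) ≡ (nw + se + w) + (n + (ne + e))
    regroup = solve-∀

    concavity : ∀ w i j → w * (i * (2 + j)) + w * ((2 + i) * j) + w + w ≡ w * ((1 + i) * (1 + j)) + w * ((1 + i) * (1 + j))
    concavity = solve-∀

  V-super : ∀ i j → W (depth i j) + (atNW 0 V i j + (V i (suc j) + (V (suc i) (suc j) + (V (suc i) j + (atSE 0 V i j + 0)))))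
                    ≤ V i j + V i j
  V-super i j = begin
    w + (nw + (n + (ne + (e + (se + 0))))) ≡⟨ regroup w nw n ne e se ⟩
    nw + se + w + (n + (ne + e))           ≤⟨ ℕₚ.+-monoʳ-≤ (nw + se + w) (raising≤W i j) ⟩
    nw + se + w + w                        ≡⟨ cong₂ (λ x y → x + y + w + w) (atNW-V i j) (atSE-V i j) ⟩
    w * (i * (2 + j)) + w * ((2 + i) * j) + w + w ≡⟨ concavity w i j ⟩
    V i j + V i j                          ∎
    where
    w = W (depth i j)
    nw = atNW 0 V i j
    se = atSE 0 V i j
    n = V i (suc j)
    ne = V (suc i) (suc j)
    e = V (suc i) j

eqPoint-sound : ∀ P Q → eqPoint P Q ≡ true → P ≡ Q
eqPoint-sound (a , b) (c , d) with a ℤ.≟ c | b ℤ.≟ d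
... | yes refl | yes refl = λ _ → refl
... | yes _    | no _     = λ ()
... | no _     | _        = λ ()

module GeneratingFunction (S : StepSet) (iQ jQ : ℕ) where

  open import Data.Nat using (_<_; _∸_)
  open import Data.Rational using (_+_; _*_; _≤_)
  open import Data.Rational.Solver using (module +-*-Solver)
  open +-*-Solver
  open Rationals
  open Transfer
  open Lattice
  open Convergence (steps S) (+ iQ , + jQ) using (δ)

  k : ℕ
  k = iQ ℕ.+ jQ

  open Depth k
  open Potential k
  open FixedPoint S k (λ i j → δ (+ i , + j))

  G : Point → ℚ
  G = extend 0ℚ solution

  private
    δ-outside : ∀ i j → k < i ℕ.+ j → δ (+ i , + j) ≡ 0ℚ
    δ-outside i j k<i+j with eqPoint (+ i , + j) (+ iQ , + jQ) in P≡Q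
    ... | true  = ⊥-elim (ℕₚ.<⇒≢ k<i+j (cong (λ P → ℤ.∣ proj₁ P ∣ ℕ.+ ℤ.∣ proj₂ P ∣)
                                              (sym (eqPoint-sound (+ i , + j) (+ iQ , + jQ) P≡Q))))
    ... | false = refl

  G-fixed : ∀ P → InQuadrant P → G P ≡ δ P + transfer (steps S) G P
  G-fixed (+ i , + j)      _ = trans (solution-eq δ-outside i j)
    (cong (_+_ (δ (+ i , + j))) (sym (transfer-extend S solution i j)))
  G-fixed (+ i , -[1+ j ]) ()
  G-fixed (-[1+ i ] , b)   ()

  C : ℚ
  C = sumBelow (λ a → sumBelow (λ b → ∣ solution a b ∣) (suc k)) (suc k)

  private
    row-nonNeg : ∀ a → 0ℚ ≤ sumBelow (λ b → ∣ solution a b ∣) (suc k)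
    row-nonNeg a = sumBelow-nonNeg (λ b → ℚₚ.0≤∣p∣ (solution a b)) (suc k)

    C-nonNeg : 0ℚ ≤ C
    C-nonNeg = sumBelow-nonNeg row-nonNeg (suc k)

    ∣solution∣≤C : ∀ i j → i ℕ.+ j ℕ.≤ k → ∣ solution i j ∣ ≤ C
    ∣solution∣≤C i j i+j≤k = ℚₚ.≤-trans
      (term≤sumBelow (λ b → ℚₚ.0≤∣p∣ (solution i b)) (ℕ.s≤s (ℕₚ.≤-trans (ℕₚ.m≤n+m j i) i+j≤k)))
      (term≤sumBelow row-nonNeg (ℕ.s≤s (ℕₚ.≤-trans (ℕₚ.m≤m+n i j) i+j≤k)))

    ∣solution∣≤C*W : ∀ i j → ∣ solution i j ∣ ≤ C * fromℕ (W (depth i j))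
    ∣solution∣≤C*W i j = bound (depth i j) refl
      where
      bound : ∀ D → D ≡ depth i j → ∣ level D i ∣ ≤ C * fromℕ (W D)
      bound zero          _  = *-nonNeg C-nonNeg (fromℕ-nonNeg 0)
      bound (suc zero)    _  = *-nonNeg C-nonNeg (fromℕ-nonNeg (W 1))
      bound (suc (suc d)) eq = begin
        ∣ level (suc (suc d)) i ∣ ≡⟨ cong (λ D → ∣ level D i ∣) eq ⟩
        ∣ solution i j ∣          ≤⟨ ∣solution∣≤C i j (subst (ℕ._≤ k) (depth≡2+d⇒level i j eq) (ℕₚ.m∸n≤m k d)) ⟩
        C                         ≡⟨ sym (ℚₚ.*-identityʳ C) ⟩
        C * 1ℚ                    ≤⟨ ℚₚ.*-monoˡ-≤-nonNeg C {{ℚ.nonNegative C-nonNeg}}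
                                       (fromℕ-mono-≤ {1} {W (suc (suc d))} (ℕ.s≤s ℕ.z≤n)) ⟩
        C * fromℕ (W (suc (suc d))) ∎
        where open ℚₚ.≤-Reasoning

  v : Point → ℚ
  v P = fromℕ (extend 0 V P) * (C + C)

  v-nonNeg : ∀ P → InQuadrant P → 0ℚ ≤ v P
  v-nonNeg P _ = *-nonNeg (fromℕ-nonNeg (extend 0 V P)) (ℚₚ.+-mono-≤ C-nonNeg C-nonNeg)

  private
    V-super-steps : ∀ i j → W (depth i j) ℕ.+ neighbourSum ℕ._+_ 0 (steps S) (extend 0 V) (+ i , + j) ℕ.≤ V i j ℕ.+ V i j
    V-super-steps i j = ℕₚ.≤-trans
      (ℕₚ.+-monoʳ-≤ (W (depth i j)) (ℕₚ.≤-trans (neighbourSum-mono-⊆ (steps⊆steps𝒞 S) (extend 0 V) (+ i , + j))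
                                               (ℕₚ.≤-reflexive (neighbourSum-extend ℕ._+_ 0 V 𝒞 i j))))
      (V-super i j)

  v-super : ∀ P → InQuadrant P → ∣ G P ∣ + transfer (steps S) v P ≤ v P
  v-super (+ i , + j)      _ = begin
    ∣ solution i j ∣ + ½ * neighbourSumℚ (steps S) v (+ i , + j)
      ≡⟨ cong (λ x → ∣ solution i j ∣ + ½ * x) (neighbourSum-fromℕ-* (steps S) (extend 0 V) (C + C) (+ i , + j)) ⟩
    ∣ solution i j ∣ + ½ * (fromℕ σ * (C + C))
      ≤⟨ ℚₚ.+-monoˡ-≤ (½ * (fromℕ σ * (C + C))) (∣solution∣≤C*W i j) ⟩
    C * fromℕ w + ½ * (fromℕ σ * (C + C))
      ≡⟨ solve 3 (λ c w s → c :* w :+ con ½ :* (s :* (c :+ c)) := (w :+ s) :* c) refl C (fromℕ w) (fromℕ σ) ⟩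
    (fromℕ w + fromℕ σ) * C
      ≡⟨ cong (_* C) (sym (fromℕ-+ w σ)) ⟩
    fromℕ (w ℕ.+ σ) * C
      ≤⟨ ℚₚ.*-monoʳ-≤-nonNeg C {{ℚ.nonNegative C-nonNeg}} (fromℕ-mono-≤ (V-super-steps i j)) ⟩
    fromℕ (V i j ℕ.+ V i j) * C
      ≡⟨ cong (_* C) (fromℕ-+ (V i j) (V i j)) ⟩
    (fromℕ (V i j) + fromℕ (V i j)) * C
      ≡⟨ solve 2 (λ x c → (x :+ x) :* c := x :* (c :+ c)) refl (fromℕ (V i j)) C ⟩
    fromℕ (V i j) * (C + C) ∎
    where
    open ℚₚ.≤-Reasoning
    w = W (depth i j)
    σ = neighbourSum ℕ._+_ 0 (steps S) (extend 0 V) (+ i , + j)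
  v-super (+ i , -[1+ j ]) ()
  v-super (-[1+ i ] , b)   ()

open import Data.Nat using (_+_; _≤_)

proposition2p11 : (S : StepSet) (k i j : ℕ) → 1 ≤ k → i + j ≡ k →
    Σ ℚ (λ q → PartialSumsConvergeTo (partialSum S (+ i , + j)) q)
proposition2p11 S _ i j _ _ =
  G (0ℤ , 0ℤ) , PartialSumsConvergeTo-cong (λ M → sym (partialSum≡partialSumFrom S (+ i , + j) M))
                  (partialSumFrom-converges G v G-fixed v-nonNeg v-super (0ℤ , 0ℤ) refl)
  where
  open GeneratingFunction S i j
  open Convergence (steps S) (+ i , + j) using (partialSumFrom-converges)
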